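{- Let $n,m\in\mathbb{N}$ with $n,m\ge1$, and let $X$ be a good instruction sequence for $\mathrm{tstnz}_n$ with $\mathrm{len}(X)=L(n)+m$. Then fewer than $6m$ input register names appear in more than one occurrence of a read instruction in $X$.
   Context: Basic instructions: $\mathtt{in}{:}i.\mathtt{get}$ ($i\ge1$), $\mathtt{out}.\mathtt{set}{:}b$ ($b\in\{0,1\}$), $\mathtt{aux}{:}i.\mathtt{get}$ ($i\ge1$), $\mathtt{aux}{:}i.\mathtt{set}{:}b$ ($i\ge1$, $b\in\{0,1\}$). The part before the dot names a Boolean register ($\mathtt{in}{:}i$ input, $\mathtt{out}$ output, $\mathtt{aux}{:}i$ auxiliary); $\mathtt{get}$ changes nothing and replies the content, $\mathtt{set}{:}b$ makes the content $b$ and replies $b$. Primitive instructions: for each basic instruction $a$, plain $a$, positive test $+a$, negative test $-a$; forward jumps $\#l$ ($l\in\mathbb{N}$); termination $!$. Instruction sequences are finite sequences $X=u_1;\dots;u_k$ of primitive instructions, $\mathrm{len}(X)=k$. Execution starts at $u_1$: plain $a$ executes $a$ and proceeds with the next instruction; $+a$ executes $a$ and proceeds with the next instruction if the reply is $1$, otherwise skips the next one and proceeds with the one after it; $-a$ likewise with replies reversed; $\#l$ proceeds with the $l$-th next instruction; $!$ terminates. If $l=0$ or there is no instruction to proceed with, execution never terminates. For $f:\{0,1\}^n\to\{0,1\}$, $X$ computes $f$ if there is $k$ such that for all $b_1,\dots,b_n$, executing $X$ with $\mathtt{in}{:}i$ initially $b_i$, $\mathtt{out}$ and $\mathtt{aux}{:}1,\dots,\mathtt{aux}{:}k$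 initially $0$ (other registers arbitrary) terminates with final content of $\mathtt{out}$ equal to $f(b_1,\dots,b_n)$. $\mathrm{tstnz}_n(b_1,\dots,b_n)=1$ iff some $b_i=1$. $L(n)=3n/2+1$ for even $n$, $3(n+1)/2$ for odd $n$. Read instructions are $+\mathtt{in}{:}i.\mathtt{get}$ and $-\mathtt{in}{:}i.\mathtt{get}$; $\mathrm{iregs}(X)$ is the set of $i$ such that $\mathtt{in}{:}i$ is read by some read instruction occurring in $X$. A good instruction sequence is one of the form $Z;\mathtt{out}.\mathtt{set}{:}1;!$ where only read instructions and forward jumps $\#l$ with $l>0$ occur in $Z$. A good instruction sequence for $\mathrm{tstnz}_n$ is a good instruction sequence $X$ with $\mathrm{iregs}(X)=\{1,\dots,n\}$ that computes $\mathrm{tstnz}_n$. -}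

module Defs where

open import Data.Nat using (ℕ; zero; suc; _+_; _*_; _≤_; _≤?_; _<_; _≟_)
open import Data.Nat.DivMod using (_/_; _%_)
open import Data.Bool using (Bool; true; false; if_then_else_)
open import Data.Nat using (_≡ᵇ_)
open import Data.Fin using (Fin; toℕ)
open import Data.Vec using (Vec; lookup; toList)
open import Data.List using (List; []; _∷_; _++_; drop; length; filter; mapMaybe; deduplicate)
open import Data.Bool.ListAction using (or)
open import Data.List.Relation.Unary.All using (All)
open import Data.List.Relation.Unary.Any using (Any)
open import Data.Maybe using (Maybe; just; nothing)
open import Data.Product using (Σ; ∃; _×_; _,_; proj₁; proj₂)
open import Data.Sum using (_⊎_)
open import Relation.Binary.PropositionalEquality using (_≡_)

-- Register indices are natural numbers; in:i, aux:i are meaningful for i ≥ 1.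

data Basic : Set where
  inGet  : ℕ → Basic
  outSet : Bool → Basic
  auxGet : ℕ → Basic
  auxSet : ℕ → Bool → Basic

data Prim : Set where
  plain : Basic → Prim
  ptest : Basic → Prim
  ntest : Basic → Prim
  jump  : ℕ → Prim
  halt  : Prim

InstrSeq : Set
InstrSeq = List Prim

len : InstrSeq → ℕ
len = length

record State : Set where
  field
    inp : ℕ → Bool
    out : Bool
    aux : ℕ → Bool
open State public

updAux : (ℕ → Bool) → ℕ → Bool → ℕ → Bool
updAux f i b j = if j ≡ᵇ i then b else f j

effect : Basic → State → Bool × State
effect (inGet i) s = inp s i , s
effect (outSet b) s = b , record s { out = b }
effect (auxGet i) s = aux s i , s
effect (auxSet i b) s = b , record s { aux = updAux (aux s) i b }

reply : Basic → State → Bool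
reply a s = proj₁ (effect a s)

next : Basic → State → State
next a s = proj₂ (effect a s)

-- Non-termination = no derivation.
-- (Proceeding with a non-existent instruction or #0 has no rule.)
data Exec : InstrSeq → State → State → Set where
  ex-halt  : ∀ {xs s} → Exec (halt ∷ xs) s s
  ex-plain : ∀ {a xs s t} → Exec xs (next a s) t → Exec (plain a ∷ xs) s t
  ex-pos-1 : ∀ {a xs s t} → reply a s ≡ true → Exec xs (next a s) t → Exec (ptest a ∷ xs) s t
  ex-pos-0 : ∀ {a xs s t} → reply a s ≡ false → Exec (drop 1 xs) (next a s) t → Exec (ptest a ∷ xs) s t
  ex-neg-0 : ∀ {a xs s t} → reply a s ≡ false → Exec xs (next a s) t → Exec (ntest a ∷ xs) s t
  ex-neg-1 : ∀ {a xs s t} → reply a s ≡ true → Exec (drop 1 xs) (next a s) t → Exec (ntest a ∷ xs) s t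
  -- #(suc l) proceeds with the (suc l)-th next instruction
  ex-jump  : ∀ {l xs s t} → Exec (drop l xs) s t → Exec (jump (suc l) ∷ xs) s t

Computes : (n : ℕ) → InstrSeq → (Vec Bool n → Bool) → Set
Computes n X f =
  Σ ℕ λ k → (b : Vec Bool n) (s : State) →
    (∀ (i : Fin n) → inp s (suc (toℕ i)) ≡ lookup b i) →
    out s ≡ false →
    (∀ j → 1 ≤ j → j ≤ k → aux s j ≡ false) →
    Σ State λ t → Exec X s t × out t ≡ f b

tstnz : (n : ℕ) → Vec Bool n → Bool
tstnz n b = or (toList b)

L : ℕ → ℕ
L n with n % 2
... | zero  = 3 * n / 2 + 1
... | suc _ = 3 * (n + 1) / 2

IsReadOf : ℕ → Prim → Set
IsReadOf i u = (u ≡ ptest (inGet i)) ⊎ (u ≡ ntest (inGet i))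

InIregs : ℕ → InstrSeq → Set
InIregs i X = Any (IsReadOf i) X

data GoodInstr : Prim → Set where
  g-pos  : ∀ i → GoodInstr (ptest (inGet i))
  g-neg  : ∀ i → GoodInstr (ntest (inGet i))
  g-jump : ∀ l → GoodInstr (jump (suc l))

Good : InstrSeq → Set
Good X = Σ InstrSeq λ Z → All GoodInstr Z × (X ≡ Z ++ (plain (outSet true) ∷ halt ∷ []))

GoodFor-tstnz : (n : ℕ) → InstrSeq → Set
GoodFor-tstnz n X =
  Good X
  × (∀ i → (InIregs i X → (1 ≤ i × i ≤ n)) × ((1 ≤ i × i ≤ n) → InIregs i X))
  × Computes n X (tstnz n)

readIdx : Prim → Maybe ℕ
readIdx (ptest (inGet i)) = just i
readIdx (ntest (inGet i)) = just i
readIdx _ = nothing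

readOccs : InstrSeq → List ℕ
readOccs = mapMaybe readIdx

occurrences : ℕ → InstrSeq → ℕ
occurrences i X = length (filter (i ≟_) (readOccs X))

multiRead : InstrSeq → List ℕ
multiRead X = filter (λ i → 2 ≤? occurrences i X) (deduplicate _≟_ (readOccs X))

-- On the all-zero input the run of X from any position either halts leaving out unchanged
-- (keeps), halts after out.set:1 (sets) or never halts (stuck); X itself keeps. On the input
-- with only in:i set, the run leaves the zero run at a read of in:i whose zero branch keeps.
-- Either its one branch sets (a pivot read), or the run along it leaves the zero run once
-- more, at a second read of in:i at a position that does not set. Weigh a read occurrence by
-- 1, plus 1 if its position does not set, plus 1 if it is a pivot: every register then
-- carries weight at least 3, and at least 4 if it is read twice, so 3n + k is at most the
-- total weight, k being the number of registers read twice. Conversely, prepending a good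
-- instruction raises weight + slack by at most 2, where the slack depends only on the first
-- two outcomes and is at most 2, so the total weight is at most 2 len X - 2. As
-- 2 L(n) ≤ 3n + 3, this leaves k ≤ 2m + 1 < 6m.
module Submission where

open import Defs
open import Data.Bool using (Bool; true; false; T; not; _∧_; if_then_else_)
open import Data.Bool.Properties using (T-≡; T-∧; T-not-≡; ∧-identityʳ; ∨-zeroʳ)
open import Data.Bool.ListAction using (or)
open import Data.Empty using (⊥; ⊥-elim)
open import Data.Fin using (Fin; toℕ; fromℕ<) renaming (zero to fzero; suc to fsuc)
open import Data.Fin.Properties using (toℕ-fromℕ<)
open import Data.List using (List; []; _∷_; _++_; drop; length; deduplicate)
open import Data.List.Properties using (drop-drop; length-++)
open import Data.List.Relation.Unary.All as All using (All; []; _∷_)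
import Data.List.Relation.Unary.All.Properties as All
open import Data.List.Relation.Unary.AllPairs using ([]; _∷_)
open import Data.List.Relation.Unary.Any using (here; there)
open import Data.List.Relation.Unary.Unique.Propositional using (Unique)
import Data.List.Relation.Unary.Unique.Propositional.Properties as Unique
open import Data.Maybe using (just; nothing)
open import Data.Nat using (ℕ; zero; suc; _+_; _*_; _≤_; _<_; _≡ᵇ_; _≤ᵇ_; _≟_; _%_; _/_; z≤n; s≤s)
open import Data.List.Relation.Unary.Unique.DecPropositional.Properties _≟_ using (deduplicate-!)
open import Data.Nat.DivMod using (m/n*n≤m)
open import Data.Nat.Properties
open import Algebra.Properties.CommutativeSemigroup +-commutativeSemigroup using (interchange; x∙yz≈y∙xz)
open import Data.Nat.Tactic.RingSolver using (solve-∀)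
open import Data.Product using (Σ; _×_; _,_; proj₁; proj₂)
open import Data.Sum using (_⊎_; inj₁; inj₂; [_,_]′)
open import Data.Vec using (Vec; toList; replicate; tabulate)
open import Data.Vec.Properties using (lookup-replicate; lookup∘tabulate)
open import Function using (_∘_; Equivalence)
open import Relation.Nullary using (¬_; Dec; yes; no)
open import Relation.Nullary.Decidable using (dec-true; dec-false)
open import Relation.Binary.PropositionalEquality

-- What the run from a position does on the all-zero input.
data Outcome : Set where
  keeps sets stuck : Outcome

nth : ℕ → List Outcome → Outcome
nth _       []       = stuck
nth zero    (t ∷ _)  = t
nth (suc k) (_ ∷ ts) = nth k ts

setOut : Outcome → Outcome
setOut keeps = sets
setOut t     = t

-- Only good tails are ever evaluated, so instructions that cannot occur in them are stuck.
step : Prim → List Outcome → Outcome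
step halt                  ts = keeps
step (plain (outSet true)) ts = setOut (nth 0 ts)
step (ptest (inGet _))     ts = nth 1 ts
step (ntest (inGet _))     ts = nth 0 ts
step (jump (suc l))        ts = nth l ts
step _                     ts = stuck

outcomes : InstrSeq → List Outcome
outcomes []       = []
outcomes (u ∷ us) = step u (outcomes us) ∷ outcomes us

outcome : InstrSeq → Outcome
outcome Y = nth 0 (outcomes Y)

nth-outcomes : ∀ k Y → nth k (outcomes Y) ≡ outcome (drop k Y)
nth-outcomes zero    Y        = refl
nth-outcomes (suc k) []       = refl
nth-outcomes (suc k) (u ∷ us) = nth-outcomes k us

setAndHalt : InstrSeq
setAndHalt = plain (outSet true) ∷ halt ∷ []

data GoodTail : InstrSeq → Set where
  []          : GoodTail []
  halt∷[]     : GoodTail (halt ∷ [])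
  set∷halt∷[] : GoodTail setAndHalt
  _∷_         : ∀ {u us} → GoodInstr u → GoodTail us → GoodTail (u ∷ us)

GoodTail-drop : ∀ k {Y} → GoodTail Y → GoodTail (drop k Y)
GoodTail-drop zero    g           = g
GoodTail-drop (suc k) []          = []
GoodTail-drop (suc k) halt∷[]     = GoodTail-drop k []
GoodTail-drop (suc k) set∷halt∷[] = GoodTail-drop k halt∷[]
GoodTail-drop (suc k) (_ ∷ g)     = GoodTail-drop k g

GoodTail-++ : ∀ {Z} → All GoodInstr Z → GoodTail (Z ++ setAndHalt)
GoodTail-++ []       = set∷halt∷[]
GoodTail-++ (g ∷ gs) = g ∷ GoodTail-++ gs

Agrees : Outcome → Bool → Bool → Set
Agrees keeps o o′ = o′ ≡ o
Agrees sets  _ o′ = o′ ≡ true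
Agrees stuck _ _  = ⊥

Agrees-nth : ∀ k Y {o o′} → Agrees (outcome (drop k Y)) o o′ → Agrees (nth k (outcomes Y)) o o′
Agrees-nth k Y = subst (λ t → Agrees t _ _) (sym (nth-outcomes k Y))

zero-run-agrees : ∀ {Y s t} → GoodTail Y → (∀ j → inp s j ≡ false) → Exec Y s t →
                  Agrees (outcome Y) (out s) (out t)
zero-run-agrees _              quiet ex-halt            = refl
zero-run-agrees set∷halt∷[]    quiet (ex-plain ex-halt) = refl
zero-run-agrees (() ∷ _)       quiet (ex-plain _)
zero-run-agrees (g-pos j ∷ _)  quiet (ex-pos-1 r _) with () ← trans (sym r) (quiet j)
zero-run-agrees (g-pos j ∷ g)  quiet (ex-pos-0 {xs = us} _ run) =
  Agrees-nth 1 us (zero-run-agrees (GoodTail-drop 1 g) quiet run)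
zero-run-agrees (g-neg j ∷ _)  quiet (ex-neg-1 r _) with () ← trans (sym r) (quiet j)
zero-run-agrees (g-neg j ∷ g)  quiet (ex-neg-0 _ run) = zero-run-agrees g quiet run
zero-run-agrees (g-jump l ∷ g) quiet (ex-jump {xs = us} run) =
  Agrees-nth l us (zero-run-agrees (GoodTail-drop l g) quiet run)

data Branches (i : ℕ) : InstrSeq → InstrSeq → InstrSeq → Set where
  +read : ∀ us → Branches i (ptest (inGet i) ∷ us) (drop 1 us) us
  -read : ∀ us → Branches i (ntest (inGet i) ∷ us) us (drop 1 us)

Branches-goodTail : ∀ {i V z o} → Branches i V z o → GoodTail V → GoodTail o
Branches-goodTail (+read _) (_ ∷ g) = g
Branches-goodTail (-read _) (_ ∷ g) = GoodTail-drop 1 g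

record Deviation (i : ℕ) (Y : InstrSeq) (s t : State) : Set where
  field
    offset             : ℕ
    zeroBranch         : InstrSeq
    oneBranch          : InstrSeq
    branches           : Branches i (drop offset Y) zeroBranch oneBranch
    zeroBranch-outcome : outcome zeroBranch ≡ outcome Y
    oneBranch-run      : Exec oneBranch s t

Deviation-shift : ∀ {i Y s t} c → outcome (drop c Y) ≡ outcome Y →
                  Deviation i (drop c Y) s t → Deviation i Y s t
Deviation-shift {i} {Y} c eq d = record
  { offset             = c + offset
  ; zeroBranch         = zeroBranch
  ; oneBranch          = oneBranch
  ; branches           = subst (λ V → Branches i V zeroBranch oneBranch) (drop-drop c offset Y) branches
  ; zeroBranch-outcome = trans zeroBranch-outcome eq
  ; oneBranch-run      = oneBranch-run
  }
  where open Deviation d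

deviation : ∀ {i Y s t} → GoodTail Y → (∀ j → inp s j ≡ true → j ≡ i) → Exec Y s t →
            ¬ Agrees (outcome Y) (out s) (out t) → Deviation i Y s t
deviation _           _ ex-halt            bad = ⊥-elim (bad refl)
deviation set∷halt∷[] _ (ex-plain ex-halt) bad = ⊥-elim (bad refl)
deviation (() ∷ _)    _ (ex-plain _)       _
deviation (g-pos j ∷ _) only (ex-pos-1 {xs = us} r run) _ with refl ← only j r = record
  { offset = 0 ; zeroBranch = drop 1 us ; oneBranch = us ; branches = +read us
  ; zeroBranch-outcome = sym (nth-outcomes 1 us) ; oneBranch-run = run }
deviation (g-pos j ∷ g) only (ex-pos-0 {xs = us} _ run) bad =
  Deviation-shift 2 (sym (nth-outcomes 1 us)) (deviation (GoodTail-drop 1 g) only run (bad ∘ Agrees-nth 1 us))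
deviation (g-neg j ∷ _) only (ex-neg-1 {xs = us} r run) _ with refl ← only j r = record
  { offset = 0 ; zeroBranch = us ; oneBranch = drop 1 us ; branches = -read us
  ; zeroBranch-outcome = refl ; oneBranch-run = run }
deviation (g-neg j ∷ g) only (ex-neg-0 _ run) bad =
  Deviation-shift 1 refl (deviation g only run bad)
deviation (g-jump l ∷ g) only (ex-jump {xs = us} run) bad =
  Deviation-shift (suc l) (sym (nth-outcomes l us)) (deviation (GoodTail-drop l g) only run (bad ∘ Agrees-nth l us))

sumTo : ℕ → (ℕ → ℕ) → ℕ
sumTo zero    f = 0
sumTo (suc n) f = f (suc n) + sumTo n f

sumTo-const : ∀ n c → sumTo n (λ _ → c) ≡ n * c
sumTo-const zero    c = refl
sumTo-const (suc n) c = cong (c +_) (sumTo-const n c)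

sumTo-+ : ∀ n f g → sumTo n (λ i → f i + g i) ≡ sumTo n f + sumTo n g
sumTo-+ zero    f g = refl
sumTo-+ (suc n) f g = begin
  f (suc n) + g (suc n) + sumTo n (λ i → f i + g i) ≡⟨ cong (f (suc n) + g (suc n) +_) (sumTo-+ n f g) ⟩
  f (suc n) + g (suc n) + (sumTo n f + sumTo n g)   ≡⟨ interchange (f (suc n)) (g (suc n)) (sumTo n f) (sumTo n g) ⟩
  f (suc n) + sumTo n f + (g (suc n) + sumTo n g)   ∎
  where
  open ≡-Reasoning

sumTo-mono : ∀ n f g → (∀ i → 1 ≤ i → i ≤ n → f i ≤ g i) → sumTo n f ≤ sumTo n g
sumTo-mono zero    _ _ _ = z≤n
sumTo-mono (suc n) f g f≤g =
  +-mono-≤ (f≤g (suc n) (s≤s z≤n) ≤-refl) (sumTo-mono n f g λ i 1≤i i≤n → f≤g i 1≤i (m≤n⇒m≤1+n i≤n))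

sumTo-≡ᵇ-above : ∀ n {j} c → n < j → sumTo n (λ i → if i ≡ᵇ j then c else 0) ≡ 0
sumTo-≡ᵇ-above zero        c _   = refl
sumTo-≡ᵇ-above (suc n) {j} c n<j rewrite dec-false (suc n ≟ j) (λ eq → <-irrefl eq n<j) =
  sumTo-≡ᵇ-above n c (<-trans (n<1+n n) n<j)

sumTo-≡ᵇ≤ : ∀ n j c → sumTo n (λ i → if i ≡ᵇ j then c else 0) ≤ c
sumTo-≡ᵇ≤ zero    j c = z≤n
sumTo-≡ᵇ≤ (suc n) j c with suc n ≟ j
... | yes refl rewrite dec-true (suc n ≟ suc n) refl | sumTo-≡ᵇ-above n c (n<1+n n) = ≤-reflexive (+-identityʳ c)
... | no  ne   rewrite dec-false (suc n ≟ j) ne = sumTo-≡ᵇ≤ n j c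

count : ℕ → (ℕ → Bool) → ℕ
count n p = sumTo n (λ i → if p i then 1 else 0)

count-∧-≤ : ∀ n (p q : ℕ → Bool) → count n (λ i → p i ∧ q i) ≤ count n p
count-∧-≤ n p q = sumTo-mono n _ _ λ i _ _ → pointwise (p i) (q i)
  where
  pointwise : ∀ a b → (if a ∧ b then 1 else 0) ≤ (if a then 1 else 0)
  pointwise true  true  = ≤-refl
  pointwise true  false = z≤n
  pointwise false _     = z≤n

count-remove : ∀ n p {x} → 1 ≤ x → x ≤ n → T (p x) →
               suc (count n (λ i → p i ∧ not (i ≡ᵇ x))) ≤ count n p
count-remove zero    p (s≤s _) ()
count-remove (suc n) p {x} 1≤x x≤1+n px with suc n ≟ x
... | yes refl rewrite dec-true (suc n ≟ suc n) refl | Equivalence.to T-≡ px =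
  s≤s (count-∧-≤ n p _)
... | no  ne   rewrite dec-false (suc n ≟ x) ne | ∧-identityʳ (p (suc n)) = begin
  suc (b + count n _) ≡⟨ sym (+-suc b _) ⟩
  b + suc (count n _) ≤⟨ +-monoʳ-≤ b (count-remove n p 1≤x (≤-pred (≤∧≢⇒< x≤1+n (ne ∘ sym))) px) ⟩
  b + count n p       ∎
  where
  open ≤-Reasoning
  b = if p (suc n) then 1 else 0

InRange : ℕ → ℕ → Set
InRange n x = 1 ≤ x × x ≤ n

unique-length≤count : ∀ n p {xs} → Unique xs → All (λ x → InRange n x × T (p x)) xs →
                      length xs ≤ count n p
unique-length≤count n p []            []                         = z≤n
unique-length≤count n p (x≢xs ∷ uxs) (((1≤x , x≤n) , px) ∷ hxs) =
  ≤-trans (s≤s (unique-length≤count n _ uxs (All.zipWith still-counted (x≢xs , hxs))))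
          (count-remove n p 1≤x x≤n px)
  where
  still-counted : ∀ {y} → _ ≢ y × (InRange n y × T (p y)) → InRange n y × T (p y ∧ not (y ≡ᵇ _))
  still-counted {y} (x≢y , r , py) =
    r , Equivalence.from T-∧ (py , Equivalence.from T-not-≡ (dec-false (y ≟ _) (x≢y ∘ sym)))

-- The weight of a read occurrence, given the outcomes at it and at its two branches.
Weight : Set
Weight = Outcome → Outcome → Outcome → ℕ

infixl 6 _⊕_
_⊕_ : Weight → Weight → Weight
(w ⊕ w′) t₀ t₁ t₂ = w t₀ t₁ t₂ + w′ t₀ t₁ t₂

readWeight : (ℕ → Bool) → Weight → Prim → List Outcome → ℕ
readWeight p w u ts with readIdx u
... | just j  = if p j then w (step u ts) (nth 0 ts) (nth 1 ts) else 0
... | nothing = 0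

weigh : (ℕ → Bool) → Weight → InstrSeq → ℕ
weigh p w []       = 0
weigh p w (u ∷ us) = readWeight p w u (outcomes us) + weigh p w us

weighAll : Weight → InstrSeq → ℕ
weighAll = weigh (λ _ → true)

weighReg : ℕ → Weight → InstrSeq → ℕ
weighReg i = weigh (i ≡ᵇ_)

Pointwise≤ : Weight → Weight → Set
Pointwise≤ w w′ = ∀ t₀ t₁ t₂ → w t₀ t₁ t₂ ≤ w′ t₀ t₁ t₂

readWeight-mono : ∀ p {w w′} → Pointwise≤ w w′ → ∀ u ts → readWeight p w u ts ≤ readWeight p w′ u ts
readWeight-mono p w≤w′ u ts with readIdx u
... | nothing = z≤n
... | just j with p j
...   | true  = w≤w′ _ _ _
...   | false = z≤n

readWeight-⊕ : ∀ p w w′ u ts → readWeight p (w ⊕ w′) u ts ≡ readWeight p w u ts + readWeight p w′ u ts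
readWeight-⊕ p w w′ u ts with readIdx u
... | nothing = refl
... | just j with p j
...   | true  = refl
...   | false = refl

readWeight-sumTo : ∀ n w u ts → sumTo n (λ i → readWeight (i ≡ᵇ_) w u ts) ≤ readWeight (λ _ → true) w u ts
readWeight-sumTo n w u ts with readIdx u
... | nothing = ≤-reflexive (trans (sumTo-const n 0) (*-zeroʳ n))
... | just j  = sumTo-≡ᵇ≤ n j _

weigh-mono : ∀ p {w w′} → Pointwise≤ w w′ → ∀ Y → weigh p w Y ≤ weigh p w′ Y
weigh-mono p w≤w′ []       = z≤n
weigh-mono p w≤w′ (u ∷ us) = +-mono-≤ (readWeight-mono p w≤w′ u (outcomes us)) (weigh-mono p w≤w′ us)

weigh-⊕ : ∀ p w w′ Y → weigh p (w ⊕ w′) Y ≡ weigh p w Y + weigh p w′ Y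
weigh-⊕ p w w′ []       = refl
weigh-⊕ p w w′ (u ∷ us) = begin
  readWeight p (w ⊕ w′) u ts + weigh p (w ⊕ w′) us  ≡⟨ cong₂ _+_ (readWeight-⊕ p w w′ u ts) (weigh-⊕ p w w′ us) ⟩
  (r + r′) + (weigh p w us + weigh p w′ us)           ≡⟨ interchange r r′ _ _ ⟩
  (r + weigh p w us) + (r′ + weigh p w′ us)           ∎
  where
  open ≡-Reasoning
  ts = outcomes us
  r  = readWeight p w u ts
  r′ = readWeight p w′ u ts

weigh-drop : ∀ p w k Y → weigh p w (drop k Y) ≤ weigh p w Y
weigh-drop p w zero    Y        = ≤-refl
weigh-drop p w (suc k) []       = z≤n
weigh-drop p w (suc k) (u ∷ us) = ≤-trans (weigh-drop p w k us) (m≤n+m _ _)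

sumTo-weighReg : ∀ n w Y → sumTo n (λ i → weighReg i w Y) ≤ weighAll w Y
sumTo-weighReg n w []       = ≤-reflexive (trans (sumTo-const n 0) (*-zeroʳ n))
sumTo-weighReg n w (u ∷ us) = begin
  sumTo n (λ i → readWeight (i ≡ᵇ_) w u ts + weighReg i w us)            ≡⟨ sumTo-+ n _ _ ⟩
  sumTo n (λ i → readWeight (i ≡ᵇ_) w u ts) + sumTo n (λ i → weighReg i w us)
    ≤⟨ +-mono-≤ (readWeight-sumTo n w u ts) (sumTo-weighReg n w us) ⟩
  readWeight (λ _ → true) w u ts + weighAll w us                          ∎
  where
  open ≤-Reasoning
  ts = outcomes us

once : Weight
once _ _ _ = 1

notSets : Weight
notSets sets _ _ = 0
notSets _    _ _ = 1

pivot : Weight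
pivot keeps keeps sets  = 1
pivot keeps sets  keeps = 1
pivot _     _     _     = 0

weight : Weight
weight = once ⊕ notSets ⊕ pivot

notSets≤once : Pointwise≤ notSets once
notSets≤once keeps _ _ = ≤-refl
notSets≤once sets  _ _ = z≤n
notSets≤once stuck _ _ = ≤-refl

pivot≤notSets : Pointwise≤ pivot notSets
pivot≤notSets keeps keeps keeps = z≤n
pivot≤notSets keeps keeps sets  = ≤-refl
pivot≤notSets keeps keeps stuck = z≤n
pivot≤notSets keeps sets  keeps = ≤-refl
pivot≤notSets keeps sets  sets  = z≤n
pivot≤notSets keeps sets  stuck = z≤n
pivot≤notSets keeps stuck _     = z≤n
pivot≤notSets sets  _     _     = z≤n
pivot≤notSets stuck _     _     = z≤n

sets? : ∀ t → Dec (t ≡ sets)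
sets? keeps = no λ ()
sets? sets  = yes refl
sets? stuck = no λ ()

notSets-≢ : ∀ {t} t₁ t₂ → t ≢ sets → notSets t t₁ t₂ ≡ 1
notSets-≢ {keeps} _ _ _  = refl
notSets-≢ {sets}  _ _ ne = ⊥-elim (ne refl)
notSets-≢ {stuck} _ _ _  = refl

disagrees : ∀ {t o o′} → o ≡ false → o′ ≡ true → t ≢ sets → ¬ Agrees t o o′
disagrees {keeps} refl refl _  ()
disagrees {sets}  _    _    ne _ = ne refl
disagrees {stuck} _    _    _  ()

weigh-oneBranch≤ : ∀ p w {i V z o} → Branches i V z o → weigh p w o ≤ weigh p w (drop 1 V)
weigh-oneBranch≤ p w (+read us) = ≤-refl
weigh-oneBranch≤ p w (-read us) = weigh-drop p w 1 us

Branches-pivot : ∀ {i V z o} → Branches i V z o → outcome z ≡ keeps → outcome o ≡ sets →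
                 1 ≤ weighReg i pivot V
Branches-pivot {i} (+read us) z≡ o≡
  rewrite trans (nth-outcomes 1 us) z≡ | o≡ | dec-true (i ≟ i) refl = s≤s z≤n
Branches-pivot {i} (-read us) z≡ o≡
  rewrite trans (nth-outcomes 1 us) o≡ | z≡ | dec-true (i ≟ i) refl = s≤s z≤n

Branches-notSets : ∀ {i V z o} → Branches i V z o → outcome z ≢ sets →
                   suc (weighReg i notSets (drop 1 V)) ≤ weighReg i notSets V
Branches-notSets {i} (+read us) ne
  rewrite nth-outcomes 1 us | notSets-≢ (outcome us) (outcome (drop 1 us)) ne | dec-true (i ≟ i) refl = ≤-refl
Branches-notSets {i} (-read us) ne
  rewrite notSets-≢ (outcome us) (nth 1 (outcomes us)) ne | dec-true (i ≟ i) refl = ≤-refl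

module _ {i Y s t} (d : Deviation i Y s t) where
  open Deviation d

  Deviation-pivot : outcome Y ≡ keeps → outcome oneBranch ≡ sets → 1 ≤ weighReg i pivot Y
  Deviation-pivot Y-keeps one-sets =
    ≤-trans (Branches-pivot branches (trans zeroBranch-outcome Y-keeps) one-sets) (weigh-drop _ pivot offset Y)

  Deviation-notSets : outcome Y ≢ sets → suc (weighReg i notSets oneBranch) ≤ weighReg i notSets Y
  Deviation-notSets ne = begin
    suc (weighReg i notSets oneBranch)                  ≤⟨ s≤s (weigh-oneBranch≤ _ notSets branches) ⟩
    suc (weighReg i notSets (drop 1 (drop offset Y)))  ≤⟨ Branches-notSets branches (ne ∘ trans (sym zeroBranch-outcome)) ⟩
    weighReg i notSets (drop offset Y)                 ≤⟨ weigh-drop _ notSets offset Y ⟩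
    weighReg i notSets Y                               ∎
    where open ≤-Reasoning

pivot-or-twice : ∀ {i X s t} → GoodTail X → outcome X ≡ keeps → (∀ j → inp s j ≡ true → j ≡ i) →
                 out s ≡ false → Exec X s t → out t ≡ true →
                 1 ≤ weighReg i pivot X ⊎ 2 ≤ weighReg i notSets X
pivot-or-twice {i} {X} {s} {t} g X-keeps only off run on =
  from-deviation (deviation g only run (disagrees off on X≢sets))
  where
  X≢sets : outcome X ≢ sets
  X≢sets = subst (_≢ sets) (sym X-keeps) λ ()

  from-deviation : Deviation i X s t → 1 ≤ weighReg i pivot X ⊎ 2 ≤ weighReg i notSets X
  from-deviation d with sets? (outcome (Deviation.oneBranch d))
  ... | yes one-sets = inj₁ (Deviation-pivot d X-keeps one-sets)
  ... | no  ne       =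
    inj₂ (≤-trans (s≤s (≤-trans (s≤s z≤n) (Deviation-notSets d₂ ne))) (Deviation-notSets d X≢sets))
    where
    open Deviation d
    d₂ = deviation (Branches-goodTail branches (GoodTail-drop offset g)) only oneBranch-run (disagrees off on ne)

occurrences≡weighReg : ∀ i X → occurrences i X ≡ weighReg i once X
occurrences≡weighReg i []       = refl
occurrences≡weighReg i (u ∷ us) with readIdx u
... | nothing = occurrences≡weighReg i us
... | just j with i ≡ᵇ j
...   | true  = cong suc (occurrences≡weighReg i us)
...   | false = occurrences≡weighReg i us

register-arith : ∀ o nt a → a ≤ nt → nt ≤ o → 1 ≤ a ⊎ 2 ≤ nt → 3 + (if 2 ≤ᵇ o then 1 else 0) ≤ o + nt + a
register-arith o nt a a≤nt nt≤o evidence = begin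
  3 + (if 2 ≤ᵇ o then 1 else 0) ≤⟨ three+ o 1≤o ⟩
  o + 2                         ≤⟨ +-monoʳ-≤ o 2≤nt+a ⟩
  o + (nt + a)                  ≡⟨ +-assoc o nt a ⟨
  o + nt + a                    ∎
  where
  open ≤-Reasoning
  1≤o : 1 ≤ o
  1≤o = ≤-trans ([ (λ 1≤a → ≤-trans 1≤a a≤nt) , ≤-trans (s≤s z≤n) ]′ evidence) nt≤o
  2≤nt+a : 2 ≤ nt + a
  2≤nt+a = [ (λ 1≤a → +-mono-≤ (≤-trans 1≤a a≤nt) 1≤a) , (λ 2≤nt → ≤-trans 2≤nt (m≤m+n nt a)) ]′ evidence
  three+ : ∀ o → 1 ≤ o → 3 + (if 2 ≤ᵇ o then 1 else 0) ≤ o + 2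
  three+ 1             _ = ≤-refl
  three+ (suc (suc o)) _ = s≤s (s≤s (m≤n+m 2 o))

pivot-or-twice⇒weight : ∀ i X → 1 ≤ weighReg i pivot X ⊎ 2 ≤ weighReg i notSets X →
                        3 + (if 2 ≤ᵇ occurrences i X then 1 else 0) ≤ weighReg i weight X
pivot-or-twice⇒weight i X evidence
  rewrite occurrences≡weighReg i X | weigh-⊕ (i ≡ᵇ_) (once ⊕ notSets) pivot X | weigh-⊕ (i ≡ᵇ_) once notSets X =
  register-arith _ _ _ (weigh-mono _ pivot≤notSets X) (weigh-mono _ notSets≤once X) evidence

slack : Outcome → Outcome → ℕ
slack keeps sets  = 1
slack sets  keeps = 0
slack _     _     = 2

slackOf : List Outcome → ℕ
slackOf ts = slack (nth 0 ts) (nth 1 ts)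

slack≤2 : ∀ t₁ t₂ → slack t₁ t₂ ≤ 2
slack≤2 keeps keeps = ≤ᵇ⇒≤ _ _ _
slack≤2 keeps sets  = ≤ᵇ⇒≤ _ _ _
slack≤2 keeps stuck = ≤ᵇ⇒≤ _ _ _
slack≤2 sets  keeps = ≤ᵇ⇒≤ _ _ _
slack≤2 sets  sets  = ≤ᵇ⇒≤ _ _ _
slack≤2 sets  stuck = ≤ᵇ⇒≤ _ _ _
slack≤2 stuck _     = ≤ᵇ⇒≤ _ _ _

+read-slack : ∀ t₁ t₂ → weight t₂ t₁ t₂ + slack t₁ t₂ ≤ 2 + slack t₂ t₁
+read-slack keeps keeps = ≤ᵇ⇒≤ _ _ _
+read-slack keeps sets  = ≤ᵇ⇒≤ _ _ _
+read-slack keeps stuck = ≤ᵇ⇒≤ _ _ _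
+read-slack sets  keeps = ≤ᵇ⇒≤ _ _ _
+read-slack sets  sets  = ≤ᵇ⇒≤ _ _ _
+read-slack sets  stuck = ≤ᵇ⇒≤ _ _ _
+read-slack stuck keeps = ≤ᵇ⇒≤ _ _ _
+read-slack stuck sets  = ≤ᵇ⇒≤ _ _ _
+read-slack stuck stuck = ≤ᵇ⇒≤ _ _ _

-read-slack : ∀ t₁ t₂ → weight t₁ t₁ t₂ + slack t₁ t₂ ≤ 2 + slack t₁ t₁
-read-slack keeps keeps = ≤ᵇ⇒≤ _ _ _
-read-slack keeps sets  = ≤ᵇ⇒≤ _ _ _
-read-slack keeps stuck = ≤ᵇ⇒≤ _ _ _
-read-slack sets  keeps = ≤ᵇ⇒≤ _ _ _
-read-slack sets  sets  = ≤ᵇ⇒≤ _ _ _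
-read-slack sets  stuck = ≤ᵇ⇒≤ _ _ _
-read-slack stuck keeps = ≤ᵇ⇒≤ _ _ _
-read-slack stuck sets  = ≤ᵇ⇒≤ _ _ _
-read-slack stuck stuck = ≤ᵇ⇒≤ _ _ _

step-slack : ∀ {u} → GoodInstr u → ∀ ts →
             readWeight (λ _ → true) weight u ts + slackOf ts ≤ 2 + slackOf (step u ts ∷ ts)
step-slack (g-pos _)  ts = +read-slack (nth 0 ts) (nth 1 ts)
step-slack (g-neg _)  ts = -read-slack (nth 0 ts) (nth 1 ts)
step-slack (g-jump l) ts = ≤-trans (slack≤2 (nth 0 ts) (nth 1 ts)) (m≤m+n 2 _)

weighAll-slack : ∀ {Z} → All GoodInstr Z →
                 weighAll weight (Z ++ setAndHalt) ≤ 2 * length Z + slackOf (outcomes (Z ++ setAndHalt))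
weighAll-slack []                = z≤n
weighAll-slack {u ∷ Z} (gu ∷ gs) = begin
  r + weighAll weight (Z ++ setAndHalt)         ≤⟨ +-monoʳ-≤ r (weighAll-slack gs) ⟩
  r + (2 * length Z + slackOf ts)               ≡⟨ x∙yz≈y∙xz r (2 * length Z) _ ⟩
  2 * length Z + (r + slackOf ts)               ≤⟨ +-monoʳ-≤ (2 * length Z) (step-slack gu ts) ⟩
  2 * length Z + (2 + slackOf (step u ts ∷ ts)) ≡⟨ 2z+[2+s]≡2[1+z]+s (length Z) _ ⟩
  2 * suc (length Z) + slackOf (step u ts ∷ ts) ∎
  where
  open ≤-Reasoning
  ts = outcomes (Z ++ setAndHalt)
  r  = readWeight (λ _ → true) weight u ts
  2z+[2+s]≡2[1+z]+s : ∀ z s → 2 * z + (2 + s) ≡ 2 * suc z + s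
  2z+[2+s]≡2[1+z]+s = solve-∀

L-bound : ∀ n → 2 * L n ≤ 3 * n + 3
L-bound n with n % 2
... | zero  = begin
  2 * (3 * n / 2 + 1)      ≡⟨ *-distribˡ-+ 2 (3 * n / 2) 1 ⟩
  2 * (3 * n / 2) + 2      ≡⟨ cong (_+ 2) (*-comm 2 (3 * n / 2)) ⟩
  3 * n / 2 * 2 + 2        ≤⟨ +-mono-≤ (m/n*n≤m (3 * n) 2) (n≤1+n 2) ⟩
  3 * n + 3                ∎
  where open ≤-Reasoning
... | suc _ = begin
  2 * (3 * (n + 1) / 2)    ≡⟨ *-comm 2 (3 * (n + 1) / 2) ⟩
  3 * (n + 1) / 2 * 2      ≤⟨ m/n*n≤m (3 * (n + 1)) 2 ⟩
  3 * (n + 1)              ≡⟨ *-distribˡ-+ 3 n 1 ⟩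
  3 * n + 3                ∎
  where open ≤-Reasoning

readOccs-iregs : ∀ {Z} → All GoodInstr Z → All (λ j → InIregs j (Z ++ setAndHalt)) (readOccs (Z ++ setAndHalt))
readOccs-iregs []              = []
readOccs-iregs (g-pos i  ∷ gs) = here (inj₁ refl) ∷ All.map there (readOccs-iregs gs)
readOccs-iregs (g-neg i  ∷ gs) = here (inj₂ refl) ∷ All.map there (readOccs-iregs gs)
readOccs-iregs (g-jump l ∷ gs) = All.map there (readOccs-iregs gs)

length-multiRead : ∀ n X → All (InRange n) (readOccs X) →
                   length (multiRead X) ≤ count n (λ i → 2 ≤ᵇ occurrences i X)
length-multiRead n X inRange =
  unique-length≤count n _ (Unique.filter⁺ twice? (deduplicate-! reads))
    (All.zip (All.filter⁺ twice? (All.deduplicate⁺ _≟_ inRange) , All.map ≤⇒≤ᵇ (All.all-filter twice? (deduplicate _≟_ reads))))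
  where
  reads  = readOccs X
  twice? = λ i → 2 ≤? occurrences i X

or-replicate-false : ∀ n → or (toList (replicate n false)) ≡ false
or-replicate-false zero    = refl
or-replicate-false (suc n) = or-replicate-false n

or-tabulate : ∀ {n} (h : Fin n → Bool) k → h k ≡ true → or (toList (tabulate h)) ≡ true
or-tabulate h fzero    hk rewrite hk = refl
or-tabulate h (fsuc k) hk rewrite or-tabulate (h ∘ fsuc) k hk = ∨-zeroʳ (h fzero)

unitVector : ∀ n → ℕ → Vec Bool n
unitVector n i = tabulate λ k → suc (toℕ k) ≡ᵇ i

tstnz-unitVector : ∀ n {i} → InRange n i → tstnz n (unitVector n i) ≡ true
tstnz-unitVector n {suc i} (_ , i<n) = or-tabulate _ (fromℕ< i<n) hit
  where
  hit : (suc (toℕ (fromℕ< i<n)) ≡ᵇ suc i) ≡ true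
  hit rewrite toℕ-fromℕ< i<n = dec-true (i ≟ i) refl

zeroInput : State
zeroInput = record { inp = λ _ → false ; out = false ; aux = λ _ → false }

unitInput : ℕ → State
unitInput i = record { inp = _≡ᵇ i ; out = false ; aux = λ _ → false }

module _ {n X} (computes : Computes n X (tstnz n)) where

  run-zeroInput : Σ State λ t → Exec X zeroInput t × out t ≡ false
  run-zeroInput with t , run , out≡ ← proj₂ computes (replicate n false) zeroInput
                                      (λ k → sym (lookup-replicate k false)) refl (λ _ _ _ → refl)
    = t , run , trans out≡ (or-replicate-false n)

  run-unitInput : ∀ {i} → InRange n i → Σ State λ t → Exec X (unitInput i) t × out t ≡ true
  run-unitInput {i} inRange with t , run , out≡ ← proj₂ computes (unitVector n i) (unitInput i)
                                                  (λ k → sym (lookup∘tabulate _ k)) refl (λ _ _ _ → refl)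
    = t , run , trans out≡ (tstnz-unitVector n inRange)

Agrees-false⇒keeps : ∀ {t o} → Agrees t false o → o ≡ false → t ≡ keeps
Agrees-false⇒keeps {keeps} _    _  = refl
Agrees-false⇒keeps {sets}  refl ()
Agrees-false⇒keeps {stuck} ()

module _ {n Z} (good : All GoodInstr Z) (iregs⊆ : ∀ i → InIregs i (Z ++ setAndHalt) → InRange n i)
         (computes : Computes n (Z ++ setAndHalt) (tstnz n)) where

  private
    X = Z ++ setAndHalt
    twice : ℕ → Bool
    twice i = 2 ≤ᵇ occurrences i X

  outcome-keeps : outcome X ≡ keeps
  outcome-keeps with _ , run , out≡ ← run-zeroInput computes =
    Agrees-false⇒keeps (zero-run-agrees (GoodTail-++ good) (λ _ → refl) run) out≡

  register-weight : ∀ i → InRange n i → 3 + (if twice i then 1 else 0) ≤ weighReg i weight X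
  register-weight i inRange with _ , run , out≡ ← run-unitInput computes inRange =
    pivot-or-twice⇒weight i X (pivot-or-twice (GoodTail-++ good) outcome-keeps only-i refl run out≡)
    where
    only-i : ∀ j → (j ≡ᵇ i) ≡ true → j ≡ i
    only-i j eq = ≡ᵇ⇒≡ j i (Equivalence.from T-≡ eq)

  weighAll-lower : 3 * n + length (multiRead X) ≤ weighAll weight X
  weighAll-lower = begin
    3 * n + length (multiRead X)               ≤⟨ +-monoʳ-≤ (3 * n) (length-multiRead n X readOccs-inRange) ⟩
    3 * n + count n twice                      ≡⟨ cong (_+ count n twice) (trans (sumTo-const n 3) (*-comm n 3)) ⟨
    sumTo n (λ _ → 3) + count n twice          ≡⟨ sumTo-+ n _ _ ⟨
    sumTo n (λ i → 3 + (if twice i then 1 else 0)) ≤⟨ sumTo-mono n _ _ (λ i 1≤i i≤n → register-weight i (1≤i , i≤n)) ⟩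
    sumTo n (λ i → weighReg i weight X)        ≤⟨ sumTo-weighReg n weight X ⟩
    weighAll weight X                          ∎
    where
    open ≤-Reasoning
    readOccs-inRange = All.map (iregs⊆ _) (readOccs-iregs good)

weighAll-upper : ∀ {Z} → All GoodInstr Z → weighAll weight (Z ++ setAndHalt) ≤ 2 * length Z + 2
weighAll-upper good = ≤-trans (weighAll-slack good) (+-monoʳ-≤ _ (slack≤2 _ _))

multiRead-arith : ∀ {n k z L m} → 3 * n + k ≤ 2 * z + 2 → z + 2 ≡ L + m → 2 * L ≤ 3 * n + 3 → 1 ≤ m → k < 6 * m
multiRead-arith {n} {k} {z} {L} {suc m} bound len L-bound _ = begin-strict
  k          ≤⟨ +-cancelʳ-≤ 2 k _ (+-cancelˡ-≤ (3 * n) _ _ k+2≤) ⟩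
  3 + 2 * m  <⟨ +-mono-<-≤ (≤ᵇ⇒≤ 4 6 _) (*-monoˡ-≤ m (≤ᵇ⇒≤ 2 6 _)) ⟩
  6 + 6 * m  ≡⟨ *-suc 6 m ⟨
  6 * suc m  ∎
  where
  open ≤-Reasoning
  3n+3+2[1+m]≡3n+[3+2m+2] : ∀ n m → 3 * n + 3 + 2 * suc m ≡ 3 * n + (3 + 2 * m + 2)
  3n+3+2[1+m]≡3n+[3+2m+2] = solve-∀
  k+2≤ : 3 * n + (k + 2) ≤ 3 * n + (3 + 2 * m + 2)
  k+2≤ = begin
    3 * n + (k + 2)         ≡⟨ +-assoc (3 * n) k 2 ⟨
    3 * n + k + 2           ≤⟨ +-monoˡ-≤ 2 bound ⟩
    2 * z + 2 + 2           ≡⟨ +-assoc (2 * z) 2 2 ⟩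
    2 * z + 4               ≡⟨ *-distribˡ-+ 2 z 2 ⟨
    2 * (z + 2)             ≡⟨ cong (2 *_) len ⟩
    2 * (L + suc m)         ≡⟨ *-distribˡ-+ 2 L (suc m) ⟩
    2 * L + 2 * suc m       ≤⟨ +-monoˡ-≤ (2 * suc m) L-bound ⟩
    3 * n + 3 + 2 * suc m   ≡⟨ 3n+3+2[1+m]≡3n+[3+2m+2] n m ⟩
    3 * n + (3 + 2 * m + 2) ∎

lemma2 : (n m : ℕ) → 1 ≤ n → 1 ≤ m → (X : InstrSeq) →
    GoodFor-tstnz n X → len X ≡ L n + m →
    length (multiRead X) < 6 * m
lemma2 n m _ 1≤m .(Z ++ setAndHalt) ((Z , good , refl) , iregs , computes) len≡ =
  multiRead-arith {n = n} (≤-trans (weighAll-lower good (proj₁ ∘ iregs) computes) (weighAll-upper good))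
                  (trans (sym (length-++ Z)) len≡) (L-bound n) 1≤m
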